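{- Let $\nu\in\mathbb{N}$ and suppose $t$ is one of the following words: (1) $t=12\cdots m12\cdots m$ for some $m\ge1$; (2) $t=\mathrm{Int}(h,\nu)$ for some $h\ge1$; (3) $t=\mathrm{Nes}(h,\nu)$ for some $h\ge1$; (4) $t=12\cdots mm\cdots21$ for some $m\ge1$. Then there exist two insertions $\mathcal{I}_1(\nu,k_1,\ell_1)$ and $\mathcal{I}_2(\nu,k_2,\ell_2)$ into $t$ with $(k_1,\ell_1)\ne(k_2,\ell_2)$ such that $t\star\mathcal{I}_1(\nu,k_1,\ell_1)\sim t\star\mathcal{I}_2(\nu,k_2,\ell_2)$. Moreover, this pair can be chosen so that: in case (1) both are repeat insertions and interleaving ($k_1<k_2\le\ell_1<\ell_2$); in case (2) both are return insertions and interleaving; in case (3) both are repeat insertions and nested ($k_1<k_2\le\ell_2<\ell_1$); in case (4) both are return insertions and nested.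
   Context: Alphabet $\Sigma=\mathbb{N}$; words are finite sequences over $\Sigma$, $|w|$ is length, $w^R$ the reverse. A double occurrence word (DOW) is a word in which every symbol occurs zero or exactly two times. An equivalence map is a morphism of $\Sigma^*$ induced by a bijection $\Sigma\to\Sigma$; $x\sim y$ means $f(x)=y$ for some equivalence map $f$. A word is in ascending order if it is empty or its first symbol is $1$ and the first occurrence of each symbol is one greater than the largest symbol preceding it. Insertions: for a DOW $w$ in ascending order with largest symbol $M$, $\nu\ge1$, $u=(M+1)\cdots(M+\nu)$ and $1\le k\le\ell\le|w|+1$, write $w=y_1y_2y_3$ with $|y_1|=k-1$, $|y_1y_2|=\ell-1$; the repeat insertion gives $w\star\rho(\nu,k,\ell)=y_1uy_2uy_3$ and the return insertion gives $w\star\tau(\nu,k,\ell)=y_1uy_2u^Ry_3$; $\mathcal I(\nu,k,\ell)$ denotes either. For $h,\nu\ge1$ let $x_i=((i-1)\nu+1)\cdots(i\nu)$, $1\le i\le h$; $\mathrm{Int}(h,\nu)=x_1\cdots x_hx_1^R\cdots x_h^R$ and $\mathrm{Nes}(h,\nu)=x_1\cdots x_hx_h\cdots x_1$. -}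

module Defs where

open import Data.Nat using (ℕ; zero; suc; _+_; _*_; _∸_; _⊔_; _≤_; _<_)
open import Data.List using (List; []; _∷_; _++_; map; reverse; take; drop; length; concat; foldr)
open import Data.Product using (Σ; _×_)
open import Function.Bundles using (_⤖_; Bijection)
open import Relation.Binary.PropositionalEquality using (_≡_)

Word : Set
Word = List ℕ

range : ℕ → ℕ → Word
range a zero    = []
range a (suc n) = range a n ++ (a + suc n ∷ [])

upto : ℕ → Word
upto = range 0

maxSym : Word → ℕ
maxSym = foldr _⊔_ 0

_∼_ : Word → Word → Set
x ∼ y = Σ (ℕ ⤖ ℕ) λ f → map (Bijection.to f) x ≡ y

data InsKind : Set where
  repeatI returnI : InsKind

-- w ⋆ I(ν,k,ℓ): w = y₁y₂y₃ with |y₁| = k-1, |y₁y₂| = ℓ-1,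
-- u = (M+1)...(M+ν);  repeat: y₁ u y₂ u y₃ ; return: y₁ u y₂ uᴿ y₃
insert : InsKind → Word → ℕ → ℕ → ℕ → Word
insert κ w ν k ℓ = y₁ ++ u ++ y₂ ++ second κ ++ y₃
  where
  u  = range (maxSym w) ν
  y₁ = take (k ∸ 1) w
  y₂ = take (ℓ ∸ k) (drop (k ∸ 1) w)
  y₃ = drop (ℓ ∸ 1) w
  second : InsKind → Word
  second repeatI = u
  second returnI = reverse u

ValidPos : Word → ℕ → ℕ → Set
ValidPos w k ℓ = (1 ≤ k) × (k ≤ ℓ) × (ℓ ≤ suc (length w))

xblk : ℕ → ℕ → Word
xblk ν i = range ((i ∸ 1) * ν) ν

Int : ℕ → ℕ → Word
Int h ν = concat (map (xblk ν) (upto h)) ++ concat (map (λ i → reverse (xblk ν i)) (upto h))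

Nes : ℕ → ℕ → Word
Nes h ν = concat (map (xblk ν) (upto h)) ++ concat (map (xblk ν) (reverse (upto h)))

repWord : ℕ → Word
repWord m = upto m ++ upto m

retWord : ℕ → Word
retWord m = upto m ++ reverse (upto m)

Interleaving : ℕ → ℕ → ℕ → ℕ → Set
Interleaving k₁ ℓ₁ k₂ ℓ₂ = (k₁ < k₂) × (k₂ ≤ ℓ₁) × (ℓ₁ < ℓ₂)

Nested : ℕ → ℕ → ℕ → ℕ → Set
Nested k₁ ℓ₁ k₂ ℓ₂ = (k₁ < k₂) × (k₂ ≤ ℓ₂) × (ℓ₂ < ℓ₁)

TwoEquivInsertions : InsKind → (ℕ → ℕ → ℕ → ℕ → Set) → Word → ℕ → Set
TwoEquivInsertions κ Shape t ν =
  Σ ℕ λ k₁ → Σ ℕ λ ℓ₁ → Σ ℕ λ k₂ → Σ ℕ λ ℓ₂ →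
    ValidPos t k₁ ℓ₁ × ValidPos t k₂ ℓ₂ × Shape k₁ ℓ₁ k₂ ℓ₂ ×
    (insert κ t ν k₁ ℓ₁ ∼ insert κ t ν k₂ ℓ₂)

-- Let M be the largest symbol of t and u = (M+1)⋯(M+ν). The permutation of ℕ exchanging the
-- blocks 1⋯M and (M+1)⋯(M+ν), keeping the order inside each, sends u·(1⋯M) to (1⋯M)·u, and
-- when M = hν it sends each x_i to x_(i+1) and u = x_(h+1) to x_1. Each word of the statement
-- is t = PQ with P = 1⋯M, and, with u′ the second copy of u (u or uᴿ), this permutation maps
-- uP to Pu, and u′Q to Qu′ (cases 1, 2) or Qu′ to u′Q (cases 3, 4, by reversing the
-- corresponding identity for Qᴿ). Hence it maps uPu′Q to PuQu′ (interleaving), resp. uPQu′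
-- to Puu′Q (nested).
module Submission where

open import Defs
open import Data.Nat using (ℕ; zero; suc; _+_; _*_; _∸_; _⊔_; _≤_; _<_; _≤?_; s≤s; z≤n)
open import Data.Nat.Properties
open import Data.List using (List; []; _∷_; _++_; map; reverse; take; drop; length; concat)
open import Data.List.Properties
open import Data.Product using (_×_; _,_)
open import Function using (_∘_)
open import Function.Bundles using (_⤖_; Bijection; mk↔ₛ′)
open import Function.Properties.Inverse using (↔⇒⤖)
open import Relation.Nullary using (yes; no)
open import Relation.Nullary.Negation using (contradiction)
open import Relation.Binary.PropositionalEquality
open import Algebra.Properties.CommutativeSemigroup +-commutativeSemigroup using () renaming (xy∙z≈xz∙y to +-right-comm)

rotate : ℕ → ℕ → ℕ → ℕ
rotate M ν zero = zero
rotate M ν (suc x) with suc x ≤? M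
... | yes _ = suc x + ν
... | no _ with suc x ≤? M + ν
...   | yes _ = suc x ∸ M
...   | no _ = suc x

rotate-low : ∀ M ν x → 1 ≤ x → x ≤ M → rotate M ν x ≡ x + ν
rotate-low M ν (suc x) _ x≤M with suc x ≤? M
... | yes _ = refl
... | no x≰M = contradiction x≤M x≰M

rotate-mid : ∀ M ν x → M < x → x ≤ M + ν → rotate M ν x ≡ x ∸ M
rotate-mid M ν (suc x) M<x x≤M+ν with suc x ≤? M
... | yes x≤M = contradiction x≤M (<⇒≱ M<x)
... | no _ with suc x ≤? M + ν
...   | yes _ = refl
...   | no x≰M+ν = contradiction x≤M+ν x≰M+ν

rotate-high : ∀ M ν x → M + ν < x → rotate M ν x ≡ x
rotate-high M ν (suc x) M+ν<x with suc x ≤? M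
... | yes x≤M = contradiction (≤-trans x≤M (m≤m+n M ν)) (<⇒≱ M+ν<x)
... | no _ with suc x ≤? M + ν
...   | yes x≤M+ν = contradiction x≤M+ν (<⇒≱ M+ν<x)
...   | no _ = refl

rotate-inverse : ∀ M ν x → rotate ν M (rotate M ν x) ≡ x
rotate-inverse M ν zero = refl
rotate-inverse M ν (suc x) with suc x ≤? M
... | yes x≤M = trans (rotate-mid ν M (suc x + ν) (s≤s (m≤n+m ν x)) x+ν≤ν+M) (m+n∸n≡m (suc x) ν)
  where
  x+ν≤ν+M : suc x + ν ≤ ν + M
  x+ν≤ν+M = subst (suc x + ν ≤_) (+-comm M ν) (+-monoˡ-≤ ν x≤M)
... | no x≰M with suc x ≤? M + ν
...   | yes x≤M+ν = trans (rotate-low ν M (suc x ∸ M) (m<n⇒0<n∸m M<x) (m≤n+o⇒m∸n≤o (suc x) M x≤M+ν))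
                          (m∸n+n≡m (<⇒≤ M<x))
  where
  M<x : M < suc x
  M<x = ≰⇒> x≰M
...   | no x≰M+ν = rotate-high ν M (suc x) (subst (_< suc x) (+-comm M ν) (≰⇒> x≰M+ν))

rotation : ℕ → ℕ → ℕ ⤖ ℕ
rotation M ν = ↔⇒⤖ (mk↔ₛ′ (rotate M ν) (rotate ν M) (rotate-inverse ν M) (rotate-inverse M ν))

length-range : ∀ a n → length (range a n) ≡ n
length-range a zero = refl
length-range a (suc n) = trans (length-++ (range a n)) (trans (cong (_+ 1) (length-range a n)) (+-comm n 1))

range-++ : ∀ a m n → range a m ++ range (a + m) n ≡ range a (m + n)
range-++ a m zero = trans (++-identityʳ (range a m)) (cong (range a) (sym (+-identityʳ m)))
range-++ a m (suc n) = begin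
    range a m ++ range (a + m) n ++ (a + m + suc n ∷ [])
  ≡⟨ sym (++-assoc (range a m) _ _) ⟩
    (range a m ++ range (a + m) n) ++ (a + m + suc n ∷ [])
  ≡⟨ cong₂ (λ xs x → xs ++ (x ∷ [])) (range-++ a m n) (+-assoc a m (suc n)) ⟩
    range a (m + n) ++ (a + (m + suc n) ∷ [])
  ≡⟨ cong (λ k → range a (m + n) ++ (a + k ∷ [])) (+-suc m n) ⟩
    range a (suc (m + n))
  ≡⟨ cong (range a) (sym (+-suc m n)) ⟩
    range a (m + suc n) ∎
  where open ≡-Reasoning

maxSym-++ : ∀ (xs ys : Word) → maxSym (xs ++ ys) ≡ maxSym xs ⊔ maxSym ys
maxSym-++ [] ys = refl
maxSym-++ (x ∷ xs) ys = trans (cong (x ⊔_) (maxSym-++ xs ys)) (sym (⊔-assoc x (maxSym xs) (maxSym ys)))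

maxSym-++-≡ : ∀ {M} (xs ys : Word) → maxSym xs ≡ M → maxSym ys ≡ M → maxSym (xs ++ ys) ≡ M
maxSym-++-≡ {M} xs ys maxxs maxys = trans (maxSym-++ xs ys) (trans (cong₂ _⊔_ maxxs maxys) (⊔-idem M))

maxSym-reverse : ∀ (xs : Word) → maxSym (reverse xs) ≡ maxSym xs
maxSym-reverse [] = refl
maxSym-reverse (x ∷ xs) = begin
    maxSym (reverse (x ∷ xs))    ≡⟨ cong maxSym (unfold-reverse x xs) ⟩
    maxSym (reverse xs ++ x ∷ []) ≡⟨ maxSym-++ (reverse xs) (x ∷ []) ⟩
    maxSym (reverse xs) ⊔ (x ⊔ 0) ≡⟨ cong₂ _⊔_ (maxSym-reverse xs) (⊔-identityʳ x) ⟩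
    maxSym xs ⊔ x                ≡⟨ ⊔-comm (maxSym xs) x ⟩
    maxSym (x ∷ xs)              ∎
  where open ≡-Reasoning

maxSym-range : ∀ a {n} → 1 ≤ n → maxSym (range a n) ≡ a + n
maxSym-range a {suc zero} _ = ⊔-identityʳ (a + 1)
maxSym-range a {suc (suc n)} _ = begin
    maxSym (range a (suc n) ++ (a + suc (suc n) ∷ []))
  ≡⟨ maxSym-++ (range a (suc n)) _ ⟩
    maxSym (range a (suc n)) ⊔ (a + suc (suc n) ⊔ 0)
  ≡⟨ cong₂ _⊔_ (maxSym-range a (s≤s z≤n)) (⊔-identityʳ _) ⟩
    (a + suc n) ⊔ (a + suc (suc n))
  ≡⟨ m≤n⇒m⊔n≡n (+-monoʳ-≤ a (n≤1+n (suc n))) ⟩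
    a + suc (suc n) ∎
  where open ≡-Reasoning

map-rotate-lower : ∀ M ν a n → a + n ≤ M → map (rotate M ν) (range a n) ≡ range (a + ν) n
map-rotate-lower M ν a zero _ = refl
map-rotate-lower M ν a (suc n) a+n≤M = begin
    map (rotate M ν) (range a n ++ (a + suc n ∷ []))
  ≡⟨ map-++ (rotate M ν) (range a n) _ ⟩
    map (rotate M ν) (range a n) ++ (rotate M ν (a + suc n) ∷ [])
  ≡⟨ cong₂ (λ xs x → xs ++ (x ∷ []))
       (map-rotate-lower M ν a n (≤-trans (+-monoʳ-≤ a (n≤1+n n)) a+n≤M))
       (rotate-low M ν (a + suc n) (subst (1 ≤_) (sym (+-suc a n)) (s≤s z≤n)) a+n≤M) ⟩
    range (a + ν) n ++ (a + suc n + ν ∷ [])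
  ≡⟨ cong (λ x → range (a + ν) n ++ (x ∷ [])) (+-right-comm a (suc n) ν) ⟩
    range (a + ν) (suc n) ∎
  where open ≡-Reasoning

map-rotate-upper : ∀ M ν n → n ≤ ν → map (rotate M ν) (range M n) ≡ range 0 n
map-rotate-upper M ν zero _ = refl
map-rotate-upper M ν (suc n) n≤ν = begin
    map (rotate M ν) (range M n ++ (M + suc n ∷ []))
  ≡⟨ map-++ (rotate M ν) (range M n) _ ⟩
    map (rotate M ν) (range M n) ++ (rotate M ν (M + suc n) ∷ [])
  ≡⟨ cong₂ (λ xs x → xs ++ (x ∷ []))
       (map-rotate-upper M ν n (≤-trans (n≤1+n n) n≤ν))
       (trans (rotate-mid M ν (M + suc n) (m<m+n M (s≤s z≤n)) (+-monoʳ-≤ M n≤ν)) (m+n∸m≡n M (suc n))) ⟩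
    range 0 (suc n) ∎
  where open ≡-Reasoning

rotate-swaps-ranges : ∀ M ν → map (rotate M ν) (range M ν ++ range 0 M) ≡ range 0 M ++ range M ν
rotate-swaps-ranges M ν = begin
    map (rotate M ν) (range M ν ++ range 0 M)
  ≡⟨ map-++ (rotate M ν) (range M ν) (range 0 M) ⟩
    map (rotate M ν) (range M ν) ++ map (rotate M ν) (range 0 M)
  ≡⟨ cong₂ _++_ (map-rotate-upper M ν ν ≤-refl) (map-rotate-lower M ν 0 M ≤-refl) ⟩
    range 0 ν ++ range ν M
  ≡⟨ range-++ 0 ν M ⟩
    range 0 (ν + M)
  ≡⟨ cong (range 0) (+-comm ν M) ⟩
    range 0 (M + ν)
  ≡⟨ sym (range-++ 0 M ν) ⟩
    range 0 M ++ range M ν ∎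
  where open ≡-Reasoning

map-swap-reverse : ∀ {A B : Set} (f : A → B) (a b : List A) (c d : List B) →
                   map f (a ++ b) ≡ c ++ d → map f (reverse b ++ reverse a) ≡ reverse d ++ reverse c
map-swap-reverse f a b c d eq = begin
    map f (reverse b ++ reverse a) ≡⟨ cong (map f) (sym (reverse-++ a b)) ⟩
    map f (reverse (a ++ b))       ≡⟨ reverse-map f (a ++ b) ⟩
    reverse (map f (a ++ b))       ≡⟨ cong reverse eq ⟩
    reverse (c ++ d)               ≡⟨ reverse-++ c d ⟩
    reverse d ++ reverse c         ∎
  where open ≡-Reasoning

concat-map-upto-suc : ∀ {A : Set} (g : ℕ → List A) n →
                      concat (map g (upto (suc n))) ≡ concat (map g (upto n)) ++ g (suc n)
concat-map-upto-suc g n = begin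
    concat (map g (upto n ++ suc n ∷ []))       ≡⟨ cong concat (map-++ g (upto n) (suc n ∷ [])) ⟩
    concat (map g (upto n) ++ g (suc n) ∷ [])   ≡⟨ sym (concat-++ (map g (upto n)) (g (suc n) ∷ [])) ⟩
    concat (map g (upto n)) ++ g (suc n) ++ []  ≡⟨ cong (concat (map g (upto n)) ++_) (++-identityʳ (g (suc n))) ⟩
    concat (map g (upto n)) ++ g (suc n)        ∎
  where open ≡-Reasoning

concat-map-reverse : ∀ {A B : Set} (g : A → List B) (xs : List A) →
                     concat (map g (reverse xs)) ≡ reverse (concat (map (reverse ∘ g) xs))
concat-map-reverse g [] = refl
concat-map-reverse g (x ∷ xs) = begin
    concat (map g (reverse (x ∷ xs)))
  ≡⟨ cong (concat ∘ map g) (unfold-reverse x xs) ⟩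
    concat (map g (reverse xs ++ x ∷ []))
  ≡⟨ cong concat (map-++ g (reverse xs) (x ∷ [])) ⟩
    concat (map g (reverse xs) ++ g x ∷ [])
  ≡⟨ sym (concat-++ (map g (reverse xs)) (g x ∷ [])) ⟩
    concat (map g (reverse xs)) ++ g x ++ []
  ≡⟨ cong₂ _++_ (concat-map-reverse g xs) (trans (++-identityʳ (g x)) (sym (reverse-involutive (g x)))) ⟩
    reverse (concat (map (reverse ∘ g) xs)) ++ reverse (reverse (g x))
  ≡⟨ sym (reverse-++ (reverse (g x)) (concat (map (reverse ∘ g) xs))) ⟩
    reverse (concat (map (reverse ∘ g) (x ∷ xs))) ∎
  where open ≡-Reasoning

length-concat-map-reverse : ∀ {A B : Set} (g : A → List B) (xs : List A) →
                            length (concat (map (reverse ∘ g) xs)) ≡ length (concat (map g xs))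
length-concat-map-reverse g [] = refl
length-concat-map-reverse g (x ∷ xs) =
  trans (length-++ (reverse (g x)))
    (trans (cong₂ _+_ (length-reverse (g x)) (length-concat-map-reverse g xs)) (sym (length-++ (g x))))

maxSym-concat-map-reverse : ∀ {A : Set} (g : A → Word) (xs : List A) →
                            maxSym (concat (map (reverse ∘ g) xs)) ≡ maxSym (concat (map g xs))
maxSym-concat-map-reverse g [] = refl
maxSym-concat-map-reverse g (x ∷ xs) =
  trans (maxSym-++ (reverse (g x)) _)
    (trans (cong₂ _⊔_ (maxSym-reverse (g x)) (maxSym-concat-map-reverse g xs)) (sym (maxSym-++ (g x) _)))

map-shift-blocks : ∀ (f : ℕ → ℕ) (g : ℕ → Word) h →
                   map f (g (suc h)) ≡ g 1 →
                   (∀ i → i < h → map f (g (suc i)) ≡ g (suc (suc i))) →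
                   map f (g (suc h) ++ concat (map g (upto h))) ≡ concat (map g (upto h)) ++ g (suc h)
map-shift-blocks f g h wrap shift = begin
    map f (g (suc h) ++ concat (map g (upto h)))
  ≡⟨ map-++ f (g (suc h)) _ ⟩
    map f (g (suc h)) ++ map f (concat (map g (upto h)))
  ≡⟨ cong (_++ map f (concat (map g (upto h)))) wrap ⟩
    g 1 ++ map f (concat (map g (upto h)))
  ≡⟨ prefix h ≤-refl ⟩
    concat (map g (upto (suc h)))
  ≡⟨ concat-map-upto-suc g h ⟩
    concat (map g (upto h)) ++ g (suc h) ∎
  where
  open ≡-Reasoning
  prefix : ∀ n → n ≤ h → g 1 ++ map f (concat (map g (upto n))) ≡ concat (map g (upto (suc n)))
  prefix zero _ = refl
  prefix (suc n) n<h = begin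
      g 1 ++ map f (concat (map g (upto (suc n))))
    ≡⟨ cong (λ w → g 1 ++ map f w) (concat-map-upto-suc g n) ⟩
      g 1 ++ map f (concat (map g (upto n)) ++ g (suc n))
    ≡⟨ cong (g 1 ++_) (map-++ f (concat (map g (upto n))) (g (suc n))) ⟩
      g 1 ++ map f (concat (map g (upto n))) ++ map f (g (suc n))
    ≡⟨ sym (++-assoc (g 1) _ _) ⟩
      (g 1 ++ map f (concat (map g (upto n)))) ++ map f (g (suc n))
    ≡⟨ cong₂ _++_ (prefix n (<⇒≤ n<h)) (shift n n<h) ⟩
      concat (map g (upto (suc n))) ++ g (suc (suc n))
    ≡⟨ sym (concat-map-upto-suc g (suc n)) ⟩
      concat (map g (upto (suc (suc n)))) ∎

blocks reversedBlocks descendingBlocks : ℕ → ℕ → Word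
blocks ν h = concat (map (xblk ν) (upto h))
reversedBlocks ν h = concat (map (reverse ∘ xblk ν) (upto h))
descendingBlocks ν h = concat (map (xblk ν) (reverse (upto h)))

blocks-range : ∀ ν h → blocks ν h ≡ range 0 (h * ν)
blocks-range ν zero = refl
blocks-range ν (suc h) = begin
    blocks ν (suc h)                   ≡⟨ concat-map-upto-suc (xblk ν) h ⟩
    blocks ν h ++ range (h * ν) ν      ≡⟨ cong (_++ range (h * ν) ν) (blocks-range ν h) ⟩
    range 0 (h * ν) ++ range (h * ν) ν ≡⟨ range-++ 0 (h * ν) ν ⟩
    range 0 (h * ν + ν)                ≡⟨ cong (range 0) (+-comm (h * ν) ν) ⟩
    range 0 (suc h * ν)                ∎
  where open ≡-Reasoning

descendingBlocks-reverse : ∀ ν h → descendingBlocks ν h ≡ reverse (reversedBlocks ν h)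
descendingBlocks-reverse ν h = concat-map-reverse (xblk ν) (upto h)

rotate-shifts-xblk : ∀ ν h i → i < h → map (rotate (h * ν) ν) (xblk ν (suc i)) ≡ xblk ν (suc (suc i))
rotate-shifts-xblk ν h i i<h =
  trans (map-rotate-lower (h * ν) ν (i * ν) ν iν+ν≤hν) (cong (λ a → range a ν) (+-comm (i * ν) ν))
  where
  iν+ν≤hν : i * ν + ν ≤ h * ν
  iν+ν≤hν = subst (_≤ h * ν) (+-comm ν (i * ν)) (*-monoˡ-≤ ν i<h)

rotate-wraps-xblk : ∀ ν h → map (rotate (h * ν) ν) (xblk ν (suc h)) ≡ xblk ν 1
rotate-wraps-xblk ν h = map-rotate-upper (h * ν) ν ν ≤-refl

rotate-shifts-blocks : ∀ ν h → let u = range (h * ν) ν in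
                       map (rotate (h * ν) ν) (u ++ blocks ν h) ≡ blocks ν h ++ u
rotate-shifts-blocks ν h = map-shift-blocks (rotate (h * ν) ν) (xblk ν) h (rotate-wraps-xblk ν h) (rotate-shifts-xblk ν h)

rotate-shifts-reversedBlocks : ∀ ν h → let u = range (h * ν) ν in
                               map (rotate (h * ν) ν) (reverse u ++ reversedBlocks ν h) ≡ reversedBlocks ν h ++ reverse u
rotate-shifts-reversedBlocks ν h =
  map-shift-blocks f (reverse ∘ xblk ν) h (under-reverse (rotate-wraps-xblk ν h))
    (λ i i<h → under-reverse (rotate-shifts-xblk ν h i i<h))
  where
  f = rotate (h * ν) ν
  under-reverse : ∀ {xs ys} → map f xs ≡ ys → map f (reverse xs) ≡ reverse ys
  under-reverse {xs} eq = trans (reverse-map f xs) (cong reverse eq)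

rotate-shifts-descendingBlocks : ∀ ν h → let u = range (h * ν) ν in
                                 map (rotate (h * ν) ν) (descendingBlocks ν h ++ u) ≡ u ++ descendingBlocks ν h
rotate-shifts-descendingBlocks ν h =
  subst (λ Y → map f (Y ++ u) ≡ u ++ Y) (sym (descendingBlocks-reverse ν h))
    (subst (λ v → map f (reverse Z ++ v) ≡ v ++ reverse Z) (reverse-involutive u)
      (map-swap-reverse f (reverse u) Z Z (reverse u) (rotate-shifts-reversedBlocks ν h)))
  where
  f = rotate (h * ν) ν
  u = range (h * ν) ν
  Z = reversedBlocks ν h

take-length-++ : ∀ {A : Set} (xs ys : List A) → take (length xs) (xs ++ ys) ≡ xs
take-length-++ [] ys = refl
take-length-++ (x ∷ xs) ys = cong (x ∷_) (take-length-++ xs ys)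

drop-length-++ : ∀ {A : Set} (xs ys : List A) → drop (length xs) (xs ++ ys) ≡ ys
drop-length-++ [] ys = refl
drop-length-++ (x ∷ xs) ys = drop-length-++ xs ys

closing : InsKind → Word → Word
closing repeatI u = u
closing returnI u = reverse u

insert-split : ∀ κ ν {M k ℓ} (t A B C : Word) → t ≡ A ++ B ++ C → maxSym t ≡ M →
               k ≡ suc (length A) → ℓ ≡ suc (length A + length B) →
               insert κ t ν k ℓ ≡ A ++ range M ν ++ B ++ closing κ (range M ν) ++ C
insert-split κ ν .(A ++ B ++ C) A B C refl refl refl refl
  rewrite take-length-++ A (B ++ C)
        | sym (drop-drop (length A) (length B) (A ++ B ++ C))
        | drop-length-++ A (B ++ C)
        | m+n∸m≡n (length A) (length B)
        | take-length-++ B C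
        | drop-length-++ B C
  with κ
... | repeatI = refl
... | returnI = refl

interleaving-positions : ∀ (t : Word) {p q} → 1 ≤ p → 1 ≤ q → length t ≡ p + q →
                         ValidPos t 1 (suc p) × ValidPos t (suc p) (suc (p + q)) ×
                         Interleaving 1 (suc p) (suc p) (suc (p + q))
interleaving-positions t {p} {q} 1≤p 1≤q |t| =
  (s≤s z≤n , s≤s z≤n , s≤s (≤-trans (m≤m+n p q) (≤-reflexive (sym |t|)))) ,
  (s≤s z≤n , s≤s (m≤m+n p q) , s≤s (≤-reflexive (sym |t|))) ,
  (s≤s 1≤p , ≤-refl , s≤s (m<m+n p 1≤q))

nested-positions : ∀ (t : Word) {p q} → 1 ≤ p → 1 ≤ q → length t ≡ p + q →
                   ValidPos t 1 (suc (p + q)) × ValidPos t (suc p) (suc p) ×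
                   Nested 1 (suc (p + q)) (suc p) (suc p)
nested-positions t {p} {q} 1≤p 1≤q |t| =
  (s≤s z≤n , s≤s z≤n , s≤s (≤-reflexive (sym |t|))) ,
  (s≤s z≤n , ≤-refl , s≤s (≤-trans (m≤m+n p q) (≤-reflexive (sym |t|)))) ,
  (s≤s 1≤p , ≤-refl , s≤s (m<m+n p 1≤q))

interleaving-pair : ∀ κ ν {M} (P Q : Word) (σ : ℕ ⤖ ℕ) →
                    1 ≤ length P → 1 ≤ length Q → maxSym P ≡ M → maxSym Q ≡ M →
                    let f = Bijection.to σ ; u = range M ν ; u′ = closing κ u in
                    map f (u ++ P) ≡ P ++ u → map f (u′ ++ Q) ≡ Q ++ u′ →
                    TwoEquivInsertions κ Interleaving (P ++ Q) ν
interleaving-pair κ ν {M} P Q σ 1≤|P| 1≤|Q| maxP maxQ uP↦Pu u′Q↦Qu′ =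
  let v₁ , v₂ , shape = interleaving-positions (P ++ Q) 1≤|P| 1≤|Q| (length-++ P) in
  1 , suc (length P) , suc (length P) , suc (length P + length Q) , v₁ , v₂ , shape , σ , images
  where
  open ≡-Reasoning
  f = Bijection.to σ
  u = range M ν
  u′ = closing κ u
  maxPQ = maxSym-++-≡ P Q maxP maxQ
  images : map f (insert κ (P ++ Q) ν 1 (suc (length P)))
         ≡ insert κ (P ++ Q) ν (suc (length P)) (suc (length P + length Q))
  images = begin
      map f (insert κ (P ++ Q) ν 1 (suc (length P)))
    ≡⟨ cong (map f) (insert-split κ ν (P ++ Q) [] P Q refl maxPQ refl refl) ⟩
      map f (u ++ P ++ u′ ++ Q)
    ≡⟨ cong (map f) (sym (++-assoc u P (u′ ++ Q))) ⟩
      map f ((u ++ P) ++ u′ ++ Q)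
    ≡⟨ map-++ f (u ++ P) (u′ ++ Q) ⟩
      map f (u ++ P) ++ map f (u′ ++ Q)
    ≡⟨ cong₂ _++_ uP↦Pu u′Q↦Qu′ ⟩
      (P ++ u) ++ Q ++ u′
    ≡⟨ ++-assoc P u (Q ++ u′) ⟩
      P ++ u ++ Q ++ u′
    ≡⟨ cong (λ w → P ++ u ++ Q ++ w) (sym (++-identityʳ u′)) ⟩
      P ++ u ++ Q ++ u′ ++ []
    ≡⟨ sym (insert-split κ ν (P ++ Q) P Q [] (cong (P ++_) (sym (++-identityʳ Q))) maxPQ refl refl) ⟩
      insert κ (P ++ Q) ν (suc (length P)) (suc (length P + length Q)) ∎

nested-pair : ∀ κ ν {M} (P Q : Word) (σ : ℕ ⤖ ℕ) →
              1 ≤ length P → 1 ≤ length Q → maxSym P ≡ M → maxSym Q ≡ M →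
              let f = Bijection.to σ ; u = range M ν ; u′ = closing κ u in
              map f (u ++ P) ≡ P ++ u → map f (Q ++ u′) ≡ u′ ++ Q →
              TwoEquivInsertions κ Nested (P ++ Q) ν
nested-pair κ ν {M} P Q σ 1≤|P| 1≤|Q| maxP maxQ uP↦Pu Qu′↦u′Q =
  let v₁ , v₂ , shape = nested-positions (P ++ Q) 1≤|P| 1≤|Q| (length-++ P) in
  1 , suc (length P + length Q) , suc (length P) , suc (length P) , v₁ , v₂ , shape , σ , images
  where
  open ≡-Reasoning
  f = Bijection.to σ
  u = range M ν
  u′ = closing κ u
  maxPQ = maxSym-++-≡ P Q maxP maxQ
  images : map f (insert κ (P ++ Q) ν 1 (suc (length P + length Q)))
         ≡ insert κ (P ++ Q) ν (suc (length P)) (suc (length P))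
  images = begin
      map f (insert κ (P ++ Q) ν 1 (suc (length P + length Q)))
    ≡⟨ cong (map f) (insert-split κ ν (P ++ Q) [] (P ++ Q) [] (sym (++-identityʳ (P ++ Q))) maxPQ
                       refl (cong suc (sym (length-++ P)))) ⟩
      map f (u ++ (P ++ Q) ++ u′ ++ [])
    ≡⟨ cong (λ w → map f (u ++ w)) (trans (++-assoc P Q (u′ ++ [])) (cong (P ++_) (sym (++-assoc Q u′ [])))) ⟩
      map f (u ++ P ++ (Q ++ u′) ++ [])
    ≡⟨ cong (map f) (sym (++-assoc u P ((Q ++ u′) ++ []))) ⟩
      map f ((u ++ P) ++ (Q ++ u′) ++ [])
    ≡⟨ map-++ f (u ++ P) ((Q ++ u′) ++ []) ⟩
      map f (u ++ P) ++ map f ((Q ++ u′) ++ [])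
    ≡⟨ cong₂ _++_ uP↦Pu (trans (cong (map f) (++-identityʳ (Q ++ u′))) Qu′↦u′Q) ⟩
      (P ++ u) ++ u′ ++ Q
    ≡⟨ ++-assoc P u (u′ ++ Q) ⟩
      P ++ u ++ u′ ++ Q
    ≡⟨ sym (insert-split κ ν (P ++ Q) P [] Q refl maxPQ refl (cong suc (sym (+-identityʳ (length P))))) ⟩
      insert κ (P ++ Q) ν (suc (length P)) (suc (length P)) ∎

range-nonempty : ∀ a {n} → 1 ≤ n → 1 ≤ length (range a n)
range-nonempty a {n} 1≤n = subst (1 ≤_) (sym (length-range a n)) 1≤n

length-blocks : ∀ ν h → length (blocks ν h) ≡ h * ν
length-blocks ν h = trans (cong length (blocks-range ν h)) (length-range 0 (h * ν))

length-reversedBlocks : ∀ ν h → length (reversedBlocks ν h) ≡ h * ν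
length-reversedBlocks ν h = trans (length-concat-map-reverse (xblk ν) (upto h)) (length-blocks ν h)

length-descendingBlocks : ∀ ν h → length (descendingBlocks ν h) ≡ h * ν
length-descendingBlocks ν h =
  trans (cong length (descendingBlocks-reverse ν h))
    (trans (length-reverse (reversedBlocks ν h)) (length-reversedBlocks ν h))

maxSym-blocks : ∀ ν h → 1 ≤ h * ν → maxSym (blocks ν h) ≡ h * ν
maxSym-blocks ν h 1≤hν = trans (cong maxSym (blocks-range ν h)) (maxSym-range 0 1≤hν)

maxSym-reversedBlocks : ∀ ν h → 1 ≤ h * ν → maxSym (reversedBlocks ν h) ≡ h * ν
maxSym-reversedBlocks ν h 1≤hν = trans (maxSym-concat-map-reverse (xblk ν) (upto h)) (maxSym-blocks ν h 1≤hν)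

maxSym-descendingBlocks : ∀ ν h → 1 ≤ h * ν → maxSym (descendingBlocks ν h) ≡ h * ν
maxSym-descendingBlocks ν h 1≤hν =
  trans (cong maxSym (descendingBlocks-reverse ν h))
    (trans (maxSym-reverse (reversedBlocks ν h)) (maxSym-reversedBlocks ν h 1≤hν))

repWord-interleaving : ∀ ν m → 1 ≤ m → TwoEquivInsertions repeatI Interleaving (repWord m) ν
repWord-interleaving ν m 1≤m =
  interleaving-pair repeatI ν (upto m) (upto m) (rotation m ν)
    (range-nonempty 0 1≤m) (range-nonempty 0 1≤m) (maxSym-range 0 1≤m) (maxSym-range 0 1≤m)
    (rotate-swaps-ranges m ν) (rotate-swaps-ranges m ν)

retWord-nested : ∀ ν m → 1 ≤ m → TwoEquivInsertions returnI Nested (retWord m) ν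
retWord-nested ν m 1≤m =
  nested-pair returnI ν (upto m) (reverse (upto m)) (rotation m ν)
    (range-nonempty 0 1≤m) (subst (1 ≤_) (sym (length-reverse (upto m))) (range-nonempty 0 1≤m))
    (maxSym-range 0 1≤m) (trans (maxSym-reverse (upto m)) (maxSym-range 0 1≤m))
    (rotate-swaps-ranges m ν)
    (map-swap-reverse (rotate m ν) (range m ν) (upto m) (upto m) (range m ν) (rotate-swaps-ranges m ν))

Int-interleaving : ∀ ν h → 1 ≤ h * ν → TwoEquivInsertions returnI Interleaving (Int h ν) ν
Int-interleaving ν h 1≤hν =
  interleaving-pair returnI ν (blocks ν h) (reversedBlocks ν h) (rotation (h * ν) ν)
    (subst (1 ≤_) (sym (length-blocks ν h)) 1≤hν) (subst (1 ≤_) (sym (length-reversedBlocks ν h)) 1≤hν)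
    (maxSym-blocks ν h 1≤hν) (maxSym-reversedBlocks ν h 1≤hν)
    (rotate-shifts-blocks ν h) (rotate-shifts-reversedBlocks ν h)

Nes-nested : ∀ ν h → 1 ≤ h * ν → TwoEquivInsertions repeatI Nested (Nes h ν) ν
Nes-nested ν h 1≤hν =
  nested-pair repeatI ν (blocks ν h) (descendingBlocks ν h) (rotation (h * ν) ν)
    (subst (1 ≤_) (sym (length-blocks ν h)) 1≤hν) (subst (1 ≤_) (sym (length-descendingBlocks ν h)) 1≤hν)
    (maxSym-blocks ν h 1≤hν) (maxSym-descendingBlocks ν h 1≤hν)
    (rotate-shifts-blocks ν h) (rotate-shifts-descendingBlocks ν h)

proposition3p5 : (ν : ℕ) → 1 ≤ ν →
    ((m : ℕ) → 1 ≤ m → TwoEquivInsertions repeatI Interleaving (repWord m) ν)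
    × ((h : ℕ) → 1 ≤ h → TwoEquivInsertions returnI Interleaving (Int h ν) ν)
    × ((h : ℕ) → 1 ≤ h → TwoEquivInsertions repeatI Nested (Nes h ν) ν)
    × ((m : ℕ) → 1 ≤ m → TwoEquivInsertions returnI Nested (retWord m) ν)
proposition3p5 ν 1≤ν =
  repWord-interleaving ν ,
  (λ h 1≤h → Int-interleaving ν h (*-mono-≤ 1≤h 1≤ν)) ,
  (λ h 1≤h → Nes-nested ν h (*-mono-≤ 1≤h 1≤ν)) ,
  retWord-nested ν
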